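{- Let $s\ge 3$ be an integer. If $G$ is a finite, connected, $d$-regular simple graph with diameter at least $s$, then \[\min_{v,r}\delta(\mathcal{L}_r(v))\leq\left\lfloor \frac{sd}{2s-1}\right\rfloor-1,\] where the minimum is over all vertices $v$ of $G$ and all integers $r\ge 1$ with $\mathcal{S}_r(v)\neq\varnothing$.
   Context: For a graph $G$, a vertex $v$ and an integer $r>0$, the sphere $\mathcal{S}_r(v)=\{w\in V(G): d(v,w)=r\}$ is the set of vertices at graph distance exactly $r$ from $v$. If $\mathcal{S}_r(v)\neq\varnothing$, the $r$-link graph of $v$ is the induced subgraph $\mathcal{L}_r(v)=G[\mathcal{S}_r(v)]$. $\delta(H)$ denotes the minimum degree of a graph $H$. -}

module Defs where

open import Data.Nat using (ℕ; zero; suc; _+_)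
open import Data.Bool using (Bool; true; false; _∧_; _∨_; not; if_then_else_)
open import Data.Fin using (Fin)
open import Data.Fin.Properties using (_≟_)
open import Data.List using (List; map)
open import Data.Nat.ListAction using (sum)
open import Data.Bool.ListAction using (any)
open import Data.List using () renaming (allFin to allFinL)
open import Relation.Nullary.Decidable using (⌊_⌋)
open import Relation.Binary.PropositionalEquality using (_≡_)

record SimpleGraph (n : ℕ) : Set where
  field
    adj      : Fin n → Fin n → Bool
    adj-sym  : ∀ u v → adj u v ≡ adj v u
    adj-irr  : ∀ v → adj v v ≡ false
open SimpleGraph public

count : {n : ℕ} → (Fin n → Bool) → ℕ
count {n} f = sum (map (λ x → if f x then 1 else 0) (allFinL n))

degree : {n : ℕ} → SimpleGraph n → Fin n → ℕ
degree G v = count (adj G v)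

Regular : {n : ℕ} → SimpleGraph n → ℕ → Set
Regular G d = ∀ v → degree G v ≡ d

-- within G k u w = true  iff  d(u,w) ≤ k  (there is a walk of length ≤ k from u to w)
within : {n : ℕ} → SimpleGraph n → ℕ → Fin n → Fin n → Bool
within {n} G zero    u w = ⌊ u ≟ w ⌋
within {n} G (suc k) u w =
  within G k u w ∨ any (λ x → within G k u x ∧ adj G x w) (allFinL n)

-- inSphere G v r w = true  iff  d(v,w) = r, i.e. w ∈ S_r(v)
inSphere : {n : ℕ} → SimpleGraph n → Fin n → ℕ → Fin n → Bool
inSphere G v zero    w = within G zero v w
inSphere G v (suc k) w = within G (suc k) v w ∧ not (within G k v w)

Connected : {n : ℕ} → SimpleGraph n → Set
Connected {n} G = ∀ (u w : Fin n) → Σ ℕ λ k → within G k u w ≡ true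
  where open import Data.Product using (Σ)

-- diameter ≥ s : some pair of vertices at distance ≥ s (i.e. not within s-1)
DiameterAtLeast : {n : ℕ} → SimpleGraph n → ℕ → Set
DiameterAtLeast {n} G zero    = Fin n   -- trivially true for nonempty graphs
DiameterAtLeast {n} G (suc t) = Σ (Fin n) λ u → Σ (Fin n) λ w → within G t u w ≡ false
  where open import Data.Product using (Σ)

-- degree of w inside the r-link graph L_r(v) = G[S_r(v)]
linkDegree : {n : ℕ} → SimpleGraph n → Fin n → ℕ → Fin n → ℕ
linkDegree G v r w = count (λ x → adj G w x ∧ inSphere G v r x)

-- Suppose every link graph L_r(u) with 1 ≤ r ≤ R has minimum degree at least m, and
-- write e_i(y) for the number of neighbours of y in S_i(u). Take x ∈ S_{j+1}(u) adjacent
-- to v ∈ S_{j+2}(u). Of the d neighbours of x, at least m are neighbours of v (the degree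
-- of x in L_1(v)) and at least m lie in S_{j+1}(u) (its degree in L_{j+1}(u)); those
-- counted twice are, like x itself, neighbours of v in S_{j+1}(u), while the e_j(x)
-- neighbours in S_j(u) and v itself fall in neither class. Hence
-- 2(m+1) + e_j(x) ≤ e_{j+1}(v) + d. Summing along a geodesic from u gives
-- 1 + 2j(m+1) ≤ e_j(w) + jd for w ∈ S_{j+1}(u); with m ≤ e_{j+1}(w) and
-- e_j(w) + e_{j+1}(w) ≤ d this is (2j+1)(m+1) ≤ (j+1)d. As (j+1)/(2j+1) decreases in j,
-- two vertices at distance ≥ s force (2s-1)(m+1) ≤ sd, which fails for m = ⌊sd/(2s-1)⌋.
module Submission where

open import Defs
open import Data.Nat using (ℕ; zero; suc; _+_; _*_; _∸_; _≤_; _<_; z≤n; s≤s; _≤?_; NonZero)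
open import Data.Nat.Properties
open import Data.Nat.DivMod using (_/_; m*n/n≡m; /-monoˡ-≤)
open import Data.Nat.ListAction using (sum)
open import Data.Nat.Tactic.RingSolver using (solve)
open import Algebra.Properties.CommutativeSemigroup +-commutativeSemigroup using (xy∙z≈xz∙y)
open import Data.Bool using (Bool; true; false; _∧_; _∨_; not; if_then_else_; T)
open import Data.Bool.Properties using (∧-conicalˡ; ∧-conicalʳ; ∧-zeroʳ; ∨-zeroʳ; not-injective; not-¬; ¬-not; T-≡)
  renaming (_≟_ to _≟ᵇ_)
open import Data.Bool.ListAction using (any)
open import Data.Fin using (Fin; toℕ; fromℕ<)
open import Data.Fin.Properties using (any?; toℕ-fromℕ<)
open import Data.List using (List; []; _∷_; map) renaming (allFin to allFinL)
open import Data.List.Membership.Propositional using (_∈_; lose)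
open import Data.List.Membership.Propositional.Properties using (∈-allFin)
open import Data.List.Relation.Unary.Any using (here; there; satisfied)
open import Data.List.Relation.Unary.Any.Properties using (any⁺; any⁻)
open import Data.Product using (Σ; _×_; _,_; proj₁; proj₂; map₂)
open import Data.Sum using (_⊎_; inj₁; inj₂; [_,_]′)
open import Data.Empty using (⊥-elim)
open import Function using (_∘_; id; Equivalence)
open import Relation.Nullary using (yes; no)
open import Relation.Nullary.Decidable using (_×-dec_; toWitness; fromWitness)
open import Relation.Binary.PropositionalEquality
  using (_≡_; refl; sym; trans; cong; cong₂; subst)

private
  variable
    A : Set

T⇒≡true : ∀ {b} → T b → b ≡ true
T⇒≡true = Equivalence.to T-≡

≡true⇒T : ∀ {b} → b ≡ true → T b
≡true⇒T = Equivalence.from T-≡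

∧-true⁻ : ∀ a {b} → a ∧ b ≡ true → a ≡ true × b ≡ true
∧-true⁻ _ p = ∧-conicalˡ _ _ p , ∧-conicalʳ _ _ p

∨-trueˡ : ∀ {a b} → a ≡ true → a ∨ b ≡ true
∨-trueˡ refl = refl

∨-trueʳ : ∀ a {b} → b ≡ true → a ∨ b ≡ true
∨-trueʳ a refl = ∨-zeroʳ a

any-true : (p : A → Bool) {x : A} {xs : List A} → x ∈ xs → p x ≡ true → any p xs ≡ true
any-true p x∈xs px = T⇒≡true (any⁺ p (lose x∈xs (≡true⇒T px)))

any-true⁻ : (p : A → Bool) (xs : List A) → any p xs ≡ true → Σ A λ x → p x ≡ true
any-true⁻ p xs h = map₂ T⇒≡true (satisfied (any⁻ p xs (≡true⇒T h)))

infixl 7 _∩_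
infix 4 _⊆_

_∩_ : (A → Bool) → (A → Bool) → A → Bool
(f ∩ g) x = f x ∧ g x

∁ : (A → Bool) → A → Bool
∁ f x = not (f x)

_⊆_ : (A → Bool) → (A → Bool) → Set
f ⊆ g = ∀ x → f x ≡ true → g x ≡ true

countIn : (A → Bool) → List A → ℕ
countIn f xs = sum (map (λ x → if f x then 1 else 0) xs)

countIn-split : (f g : A → Bool) (xs : List A) →
  countIn f xs ≡ countIn (f ∩ g) xs + countIn (f ∩ ∁ g) xs
countIn-split f g [] = refl
countIn-split f g (x ∷ xs) with f x | g x
... | true  | true  = cong suc (countIn-split f g xs)
... | true  | false = trans (cong suc (countIn-split f g xs)) (sym (+-suc _ _))
... | false | _     = countIn-split f g xs

countIn-mono : {f g : A → Bool} (xs : List A) → f ⊆ g → countIn f xs ≤ countIn g xs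
countIn-mono [] f⊆g = z≤n
countIn-mono {f = f} {g} (x ∷ xs) f⊆g with f x in fx | g x in gx
... | true  | true  = s≤s (countIn-mono xs f⊆g)
... | true  | false = ⊥-elim (not-¬ (f⊆g x fx) gx)
... | false | true  = m≤n⇒m≤1+n (countIn-mono xs f⊆g)
... | false | false = countIn-mono xs f⊆g

countIn-< : {f g : A → Bool} {xs : List A} {p : A} → f ⊆ g →
  p ∈ xs → f p ≡ false → g p ≡ true → countIn f xs < countIn g xs
countIn-< {xs = x ∷ xs} f⊆g (here refl) fp gp rewrite fp | gp = s≤s (countIn-mono xs f⊆g)
countIn-< {f = f} {g} {x ∷ xs} f⊆g (there p∈xs) fp gp with f x in fx | g x in gx
... | true  | true  = s≤s (countIn-< f⊆g p∈xs fp gp)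
... | true  | false = ⊥-elim (not-¬ (f⊆g x fx) gx)
... | false | true  = m≤n⇒m≤1+n (countIn-< f⊆g p∈xs fp gp)
... | false | false = countIn-< f⊆g p∈xs fp gp

module _ {n : ℕ} where

  count-split : (f g : Fin n → Bool) → count f ≡ count (f ∩ g) + count (f ∩ ∁ g)
  count-split f g = countIn-split f g (allFinL n)

  count-mono : {f g : Fin n → Bool} → f ⊆ g → count f ≤ count g
  count-mono = countIn-mono (allFinL n)

  count-< : {f g : Fin n → Bool} (p : Fin n) → f ⊆ g → f p ≡ false → g p ≡ true →
    count f < count g
  count-< p f⊆g = countIn-< f⊆g (∈-allFin p)

m*n≤o⇒m≤o/n : ∀ m {n o} .{{_ : NonZero n}} → m * n ≤ o → m ≤ o / n
m*n≤o⇒m≤o/n m {n} m*n≤o = subst (_≤ _) (m*n/n≡m m n) (/-monoˡ-≤ n m*n≤o)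

[1+2j]k≤[1+j]d⇒[1+2i]k≤[1+i]d : ∀ {i j k d} → i ≤ j →
  suc (2 * j) * k ≤ suc j * d → suc (2 * i) * k ≤ suc i * d
[1+2j]k≤[1+j]d⇒[1+2i]k≤[1+i]d {i} {j} {k} {d} i≤j bound with 2 * k ≤? d
... | yes 2k≤d = begin
  suc (2 * i) * k       ≤⟨ *-monoˡ-≤ k (n≤1+n (suc (2 * i))) ⟩
  suc (suc (2 * i)) * k ≡⟨ solve (i ∷ k ∷ []) ⟩
  suc i * (2 * k)       ≤⟨ *-monoʳ-≤ (suc i) 2k≤d ⟩
  suc i * d             ∎
  where open ≤-Reasoning
... | no 2k≰d with e , refl ← m≤n⇒∃[o]m+o≡n i≤j = +-cancelʳ-≤ (e * (2 * k)) _ _ (begin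
  suc (2 * i) * k + e * (2 * k) ≡⟨ solve (i ∷ e ∷ k ∷ []) ⟩
  suc (2 * (i + e)) * k         ≤⟨ bound ⟩
  suc (i + e) * d               ≡⟨ solve (i ∷ e ∷ d ∷ []) ⟩
  suc i * d + e * d             ≤⟨ +-monoʳ-≤ (suc i * d) (*-monoʳ-≤ e (<⇒≤ (≰⇒> 2k≰d))) ⟩
  suc i * d + e * (2 * k)       ∎)
  where open ≤-Reasoning

linkDegree-step-arith : ∀ {m c₀ a₁ a₂ A Q c d} → m ≤ a₁ → m ≤ A + Q →
  c₀ + Q < a₂ → A < c → d ≡ a₁ + a₂ → 2 * suc m + c₀ ≤ c + d
linkDegree-step-arith {m} {c₀} {a₁} {a₂} {A} {Q} {c} {d} m≤a₁ m≤A+Q c₀+Q<a₂ A<c d≡ = begin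
  2 * suc m + c₀              ≡⟨ solve (m ∷ c₀ ∷ []) ⟩
  m + (m + suc (suc c₀))      ≤⟨ +-mono-≤ m≤a₁ (+-monoˡ-≤ (suc (suc c₀)) m≤A+Q) ⟩
  a₁ + (A + Q + suc (suc c₀)) ≡⟨ solve (a₁ ∷ A ∷ Q ∷ c₀ ∷ []) ⟩
  suc A + (a₁ + suc (c₀ + Q)) ≤⟨ +-mono-≤ A<c (+-monoʳ-≤ a₁ c₀+Q<a₂) ⟩
  c + (a₁ + a₂)               ≡⟨ cong (c +_) d≡ ⟨
  c + d                       ∎
  where open ≤-Reasoning

module _ {n : ℕ} (G : SimpleGraph n) where

  LinkDegreesAtLeast : ℕ → ℕ → Set
  LinkDegreesAtLeast R m = ∀ u r w → 1 ≤ r → r ≤ R → inSphere G u r w ≡ true →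
    m ≤ linkDegree G u r w

  within-weaken : ∀ k {u w} → within G k u w ≡ true → within G (suc k) u w ≡ true
  within-weaken k p = ∨-trueˡ p

  within-mono : ∀ k {k′ u w} → k ≤ k′ → within G k u w ≡ true → within G k′ u w ≡ true
  within-mono k k≤k′ p with m≤n⇒m<n∨m≡n k≤k′
  ... | inj₂ refl = p
  within-mono k {suc k′} _ p | inj₁ (s≤s k≤k′) = within-weaken k′ (within-mono k k≤k′ p)

  within-step : ∀ k {u y w} → within G k u y ≡ true → adj G y w ≡ true →
    within G (suc k) u w ≡ true
  within-step k {u} {y} {w} p y~w =
    ∨-trueʳ (within G k u w) (any-true _ (∈-allFin y) (cong₂ _∧_ p y~w))

  within-pred : ∀ k {u w} → within G (suc k) u w ≡ true → within G k u w ≡ false →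
    Σ (Fin n) λ y → within G k u y ≡ true × adj G y w ≡ true
  within-pred k {u} {w} p q = map₂ (∧-true⁻ _) (any-true⁻ _ (allFinL n) reached)
    where
    arrives : Fin n → Bool
    arrives y = within G k u y ∧ adj G y w
    reached : any arrives (allFinL n) ≡ true
    reached = subst (λ b → b ∨ any arrives (allFinL n) ≡ true) q p

  within-zero⇒≡ : ∀ {u w} → within G 0 u w ≡ true → u ≡ w
  within-zero⇒≡ p = toWitness (≡true⇒T p)

  within-zero-refl : ∀ u → within G 0 u u ≡ true
  within-zero-refl u = T⇒≡true (fromWitness refl)

  inSphere-suc⁻ : ∀ k {u y} → inSphere G u (suc k) y ≡ true →
    within G (suc k) u y ≡ true × within G k u y ≡ false
  inSphere-suc⁻ k p = map₂ not-injective (∧-true⁻ _ p)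

  inSphere-suc⁺ : ∀ k {u y} → within G (suc k) u y ≡ true → within G k u y ≡ false →
    inSphere G u (suc k) y ≡ true
  inSphere-suc⁺ k p q = cong₂ _∧_ p (cong not q)

  inSphere⇒within : ∀ r {u y} → inSphere G u r y ≡ true → within G r u y ≡ true
  inSphere⇒within zero    p = p
  inSphere⇒within (suc r) p = proj₁ (inSphere-suc⁻ r p)

  inSphere-disjoint : ∀ r {r′ u y} → r < r′ →
    inSphere G u r′ y ≡ true → inSphere G u r y ≡ false
  inSphere-disjoint r {suc k} (s≤s r≤k) q =
    ¬-not λ p → not-¬ (within-mono r r≤k (inSphere⇒within r p)) (proj₂ (inSphere-suc⁻ k q))

  inSphere-parent : ∀ j {u v} → inSphere G u (suc (suc j)) v ≡ true →
    Σ (Fin n) λ x → inSphere G u (suc j) x ≡ true × adj G x v ≡ true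
  inSphere-parent j p with near , far ← inSphere-suc⁻ (suc j) p
                      with x , u~x , x~v ← within-pred (suc j) near far =
    x , inSphere-suc⁺ j u~x (¬-not λ q → not-¬ (within-step j q x~v) far) , x~v

  inSphere-one⇒adj : ∀ {u v} → inSphere G u 1 v ≡ true → adj G u v ≡ true
  inSphere-one⇒adj {v = v} p with near , far ← inSphere-suc⁻ 0 p
                             with y , u≡y , y~v ← within-pred 0 near far =
    subst (λ z → adj G z v ≡ true) (sym (within-zero⇒≡ u≡y)) y~v

  adj⇒inSphere-one : ∀ {u v} → adj G u v ≡ true → inSphere G u 1 v ≡ true
  adj⇒inSphere-one {u} u~v = inSphere-suc⁺ 0 (within-step 0 (within-zero-refl u) u~v)
    (¬-not λ u≡v → not-¬ (subst (λ z → adj G u z ≡ true) (sym (within-zero⇒≡ u≡v)) u~v)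
                         (adj-irr G u))

  inSphere-beyond : ∀ k t {u w} → within G k u w ≡ true → within G t u w ≡ false →
    Σ ℕ λ j → t ≤ j × inSphere G u (suc j) w ≡ true
  inSphere-beyond zero t p q = ⊥-elim (not-¬ (within-mono 0 {t} z≤n p) q)
  inSphere-beyond (suc k) t {u} {w} p q with within G k u w ≟ᵇ true
  ... | yes near = inSphere-beyond k t near q
  ... | no  far  with t ≤? k
  ...   | yes t≤k = k , t≤k , inSphere-suc⁺ k p (¬-not far)
  ...   | no  t≰k = ⊥-elim (not-¬ (within-mono (suc k) (≰⇒> t≰k) p) q)

  linkDegree-disjoint : ∀ {r r′ u w} → r < r′ →
    linkDegree G u r w + linkDegree G u r′ w ≤ degree G w
  linkDegree-disjoint {r} {r′} {u} {w} r<r′ = begin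
    linkDegree G u r w + linkDegree G u r′ w      ≤⟨ +-monoʳ-≤ (linkDegree G u r w) (count-mono outer⊆) ⟩
    count (N ∩ S) + count (N ∩ ∁ S)               ≡⟨ count-split N S ⟨
    degree G w                                    ∎
    where
    open ≤-Reasoning
    N S : Fin n → Bool
    N = adj G w
    S = inSphere G u r
    outer⊆ : N ∩ inSphere G u r′ ⊆ N ∩ ∁ S
    outer⊆ y h = let w~y , y∈S = ∧-true⁻ (N y) h in
      cong₂ _∧_ w~y (cong not (inSphere-disjoint r r<r′ y∈S))

  linkDegree-step : ∀ j {u x v m} →
    inSphere G u (suc j) x ≡ true → inSphere G u (suc (suc j)) v ≡ true → adj G x v ≡ true →
    m ≤ linkDegree G v 1 x → m ≤ linkDegree G u (suc j) x →
    2 * suc m + linkDegree G u j x ≤ linkDegree G u (suc j) v + degree G x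
  linkDegree-step j {u} {x} {v} {m} x∈S₁ v∈S₂ x~v m≤common m≤level =
    linkDegree-step-arith common level away shared (count-split N V)
    where
    N V S₀ S₁ : Fin n → Bool
    N = adj G x
    V = adj G v
    S₀ = inSphere G u j
    S₁ = inSphere G u (suc j)

    common : m ≤ count (N ∩ V)
    common = ≤-trans m≤common (count-mono {f = N ∩ inSphere G v 1} {g = N ∩ V} λ y h →
      let x~y , y∈S = ∧-true⁻ (N y) h in cong₂ _∧_ x~y (inSphere-one⇒adj y∈S))

    level : m ≤ count (N ∩ S₁ ∩ V) + count (N ∩ S₁ ∩ ∁ V)
    level = subst (m ≤_) (count-split (N ∩ S₁) V) m≤level

    below : linkDegree G u j x ≤ count (N ∩ ∁ V ∩ S₀)
    below = count-mono {f = N ∩ S₀} {g = N ∩ ∁ V ∩ S₀} λ y h →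
      let x~y , y∈S₀ = ∧-true⁻ (N y) h
          v≁y = ¬-not λ v~y → not-¬ (within-step j (inSphere⇒within j y∈S₀)
                                        (trans (adj-sym G y v) v~y))
                                    (proj₂ (inSphere-suc⁻ (suc j) v∈S₂))
      in cong₂ _∧_ (cong₂ _∧_ x~y (cong not v≁y)) y∈S₀

    above : count (N ∩ S₁ ∩ ∁ V) < count (N ∩ ∁ V ∩ ∁ S₀)
    above = count-< {f = N ∩ S₁ ∩ ∁ V} {g = N ∩ ∁ V ∩ ∁ S₀} v
      (λ y h → let x~y,y∈S₁ , v≁y = ∧-true⁻ (N y ∧ S₁ y) h ; x~y , y∈S₁ = ∧-true⁻ (N y) x~y,y∈S₁ in
        cong₂ _∧_ (cong₂ _∧_ x~y v≁y) (cong not (inSphere-disjoint j (n<1+n j) y∈S₁)))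
      (trans (cong (λ b → (N v ∧ b) ∧ not (V v)) v∉S₁) (cong (_∧ not (V v)) (∧-zeroʳ (N v))))
      (cong₂ _∧_ (cong₂ _∧_ x~v (cong not (adj-irr G v))) (cong not v∉S₀))
      where
      v∉S₀ : S₀ v ≡ false
      v∉S₀ = inSphere-disjoint j (m<n⇒m<1+n (n<1+n j)) v∈S₂
      v∉S₁ : S₁ v ≡ false
      v∉S₁ = inSphere-disjoint (suc j) (n<1+n (suc j)) v∈S₂

    away : linkDegree G u j x + count (N ∩ S₁ ∩ ∁ V) < count (N ∩ ∁ V)
    away = <-≤-trans (+-mono-≤-< below above) (≤-reflexive (sym (count-split (N ∩ ∁ V) S₀)))

    shared : count (N ∩ S₁ ∩ V) < linkDegree G u (suc j) v
    shared = count-< {f = N ∩ S₁ ∩ V} {g = V ∩ S₁} x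
      (λ y h → let x~y,y∈S₁ , v~y = ∧-true⁻ (N y ∧ S₁ y) h in cong₂ _∧_ v~y (proj₂ (∧-true⁻ (N y) x~y,y∈S₁)))
      (cong (λ b → (b ∧ S₁ x) ∧ V x) (adj-irr G x))
      (cong₂ _∧_ (trans (adj-sym G v x) x~v) x∈S₁)

  linkDegree-dichotomy : ∀ R m →
    (Σ (Fin n) λ u → Σ ℕ λ r → Σ (Fin n) λ w →
      (1 ≤ r) × (inSphere G u r w ≡ true) × (linkDegree G u r w + 1 ≤ m))
    ⊎ LinkDegreesAtLeast R m
  linkDegree-dichotomy R m with any? (λ u → any? (λ (r : Fin (suc R)) → any? (λ w →
      (1 ≤? toℕ r) ×-dec (inSphere G u (toℕ r) w ≟ᵇ true) ×-dec (linkDegree G u (toℕ r) w + 1 ≤? m))))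
  ... | yes (u , r , w , small) = inj₁ (u , toℕ r , w , small)
  ... | no none = inj₂ λ u r w 1≤r r≤R w∈S → ≮⇒≥ λ small →
    none (u , fromℕ< (s≤s r≤R) , w ,
      subst (λ r → (1 ≤ r) × (inSphere G u r w ≡ true) × (linkDegree G u r w + 1 ≤ m))
            (sym (toℕ-fromℕ< (s≤s r≤R)))
            (1≤r , w∈S , subst (_≤ m) (+-comm 1 _) small))

  module _ {d R m : ℕ} (regular : Regular G d) (large : LinkDegreesAtLeast R m) where

    linkDegree-growth : ∀ j {u v} → suc j ≤ R → inSphere G u (suc j) v ≡ true →
      suc (j * (2 * suc m)) ≤ linkDegree G u j v + j * d
    linkDegree-growth zero {u} {v} _ v∈S₁ = ≤-trans u-counted (m≤m+n _ 0)
      where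
      u-counted : 1 ≤ linkDegree G u 0 v
      u-counted = ≤-trans (s≤s z≤n)
        (count-< {f = λ _ → false} {g = adj G v ∩ inSphere G u 0} u (λ _ ()) refl
          (cong₂ _∧_ (trans (adj-sym G v u) (inSphere-one⇒adj v∈S₁)) (within-zero-refl u)))
    linkDegree-growth (suc j) {u} {v} j+2≤R v∈S₂
      with x , x∈S₁ , x~v ← inSphere-parent j v∈S₂ = begin
      suc (suc j * M)                          ≡⟨ +-suc M (j * M) ⟨
      M + suc (j * M)                          ≤⟨ +-monoʳ-≤ M (linkDegree-growth j j+1≤R x∈S₁) ⟩
      M + (linkDegree G u j x + j * d)         ≡⟨ +-assoc M _ _ ⟨
      M + linkDegree G u j x + j * d           ≤⟨ +-monoˡ-≤ (j * d) step ⟩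
      linkDegree G u (suc j) v + d + j * d     ≡⟨ +-assoc _ d (j * d) ⟩
      linkDegree G u (suc j) v + suc j * d     ∎
      where
      open ≤-Reasoning
      M : ℕ
      M = 2 * suc m
      j+1≤R : suc j ≤ R
      j+1≤R = ≤-trans (n≤1+n (suc j)) j+2≤R
      step : M + linkDegree G u j x ≤ linkDegree G u (suc j) v + d
      step = subst (λ e → M + linkDegree G u j x ≤ linkDegree G u (suc j) v + e) (regular x)
        (linkDegree-step j x∈S₁ v∈S₂ x~v
          (large v 1 x ≤-refl (≤-trans (s≤s z≤n) j+2≤R) (adj⇒inSphere-one (trans (adj-sym G v x) x~v)))
          (large u (suc j) x (s≤s z≤n) j+1≤R x∈S₁))

    linkDegree-bound : ∀ j {u w} → suc j ≤ R → inSphere G u (suc j) w ≡ true →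
      suc (2 * j) * suc m ≤ suc j * d
    linkDegree-bound j {u} {w} j+1≤R w∈S = begin
      suc (2 * j) * suc m          ≡⟨ solve (j ∷ m ∷ []) ⟩
      suc (j * (2 * suc m)) + m    ≤⟨ +-mono-≤ (linkDegree-growth j j+1≤R w∈S)
                                               (large u (suc j) w (s≤s z≤n) j+1≤R w∈S) ⟩
      e₀ + j * d + e₁              ≡⟨ xy∙z≈xz∙y e₀ (j * d) e₁ ⟩
      e₀ + e₁ + j * d              ≤⟨ +-monoˡ-≤ (j * d) (linkDegree-disjoint {j} {suc j} {u} {w} (n<1+n j)) ⟩
      degree G w + j * d           ≡⟨ cong (_+ j * d) (regular w) ⟩
      suc j * d                    ∎
      where
      open ≤-Reasoning
      e₀ e₁ : ℕ
      e₀ = linkDegree G u j w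
      e₁ = linkDegree G u (suc j) w

theorem2 : (s : ℕ) → 3 ≤ s → (n d : ℕ) → (G : SimpleGraph n) →
    Connected G → Regular G d → DiameterAtLeast G s →
    Σ (Fin n) λ v → Σ ℕ λ r → Σ (Fin n) λ w →
    (1 ≤ r) × (inSphere G v r w ≡ true) ×
    (linkDegree G v r w + 1 ≤ (s * d) / suc (2 * s ∸ 2))
theorem2 (suc s) _ n d G connected regular (u , w , far)
  with k , near ← connected u w
  with j , s≤j , w∈S ← inSphere-beyond G k s near far =
  [ id , ⊥-elim ∘ 1+n≰n ∘ bounded ]′ (linkDegree-dichotomy G (suc j) B)
  where
  B : ℕ
  B = suc s * d / suc (2 * suc s ∸ 2)
  bounded : LinkDegreesAtLeast G (suc j) B → suc B ≤ B
  bounded large = m*n≤o⇒m≤o/n (suc B)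
    (subst (λ q → suc B * suc q ≤ suc s * d) (*-distribˡ-∸ 2 (suc s) 1)
      (subst (_≤ suc s * d) (*-comm (suc (2 * s)) (suc B))
        ([1+2j]k≤[1+j]d⇒[1+2i]k≤[1+i]d s≤j (linkDegree-bound G regular large j ≤-refl w∈S))))
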